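{- Let $\mathcal{G}=(g_1,g_2,\dots)$ be the list defined below. Then every nonzero ZF-word (words identified up to leading zeros) occurs exactly once in $\mathcal{G}$, so that $g_n\mapsto n$ is a bijection from the set of nonzero ZF-words onto $\mathbb{N}^*$. Moreover, for every $n\geq 1$, \[h(g_n,g_{n+1})=\begin{cases}2&\text{if } n+1=F_k \text{ for some } k\geq 3,\\ 1&\text{otherwise.}\end{cases}\]
   Context: Fibonacci numbers: $F_1=F_2=1$, $F_{m+2}=F_{m+1}+F_m$. A ZF-word is a binary word with no two consecutive $1$s; words differing only by leading zeros are identified, and a word is nonzero if it contains a $1$. For a list $\mathcal{L}$ of words: $w\mathcal{L}$ prefixes the word $w$ to each element; $\mathcal{L}'$ removes the leftmost letter of each element; $\overline{\mathcal{L}}$ is the list in reverse order; $\mathcal{L}_1+\mathcal{L}_2$ is concatenation of lists. Define $\mathcal{N}_0=\varnothing$ (empty list), $\mathcal{N}_1=(1)$, and for $n\geq 2$, $\mathcal{N}_n=10\overline{\mathcal{N}_{n-1}'}+10\overline{\mathcal{N}_{n-2}}$ (so e.g. $\mathcal{N}_2=(10)$, $\mathcal{N}_3=(100,101)$, $\mathcal{N}_4=(1001,1000,1010)$). Let $\mathcal{G}=\mathcal{N}_1+\mathcal{N}_2+\mathcal{N}_3+\cdots=(g_1,g_2,\dots)$. The Hamming distance $h(w,w')$ is the number of positions where $w,w'$ differ, after padding the shorter word with leading zeros to equal length. -}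

module Defs where

open import Data.Nat using (ℕ; zero; suc; _+_; _∸_; _⊔_)
open import Data.Bool using (Bool; true; false; if_then_else_)
open import Data.List using (List; []; _∷_; _++_; map; reverse; concat; length; replicate; zipWith)
open import Data.Nat.ListAction using (sum)
open import Data.Unit using (⊤)
open import Data.Empty using (⊥)
open import Relation.Binary.PropositionalEquality using (_≡_)
open import Data.List.Relation.Unary.Any using (Any)

fib : ℕ → ℕ
fib zero = zero
fib (suc zero) = suc zero
fib (suc (suc n)) = fib (suc n) + fib n

-- Words: lists of bits, most significant (leftmost) letter first; true = 1.
Word : Set
Word = List Bool

ZF : Word → Set
ZF [] = ⊤
ZF (true ∷ true ∷ w) = ⊥
ZF (x ∷ w) = ZF w

NonzeroWord : Word → Set
NonzeroWord w = Any (λ b → b ≡ true) w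

strip : Word → Word
strip [] = []
strip (false ∷ w) = strip w
strip (true ∷ w) = true ∷ w

_≈w_ : Word → Word → Set
w ≈w w' = strip w ≡ strip w'

tail' : Word → Word
tail' [] = []
tail' (_ ∷ w) = w

pre10 : List Word → List Word
pre10 = map (λ w → true ∷ false ∷ w)

N : ℕ → List Word
N zero = []
N (suc zero) = (true ∷ []) ∷ []
N (suc (suc n)) = pre10 (reverse (map tail' (N (suc n)))) ++ pre10 (reverse (N n))

Gupto : ℕ → List Word
Gupto zero = []
Gupto (suc m) = Gupto m ++ N (suc m)

nth : List Word → ℕ → Word
nth [] _ = []
nth (x ∷ xs) zero = x
nth (x ∷ xs) (suc i) = nth xs i

-- g n = n-th element (1-indexed) of G = N_1 + N_2 + ...  (for n ≥ 1).
-- Each N_k (k ≥ 1) is nonempty, so the prefix N_1 + ... + N_n has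
-- at least n elements and this is the true n-th element of G.
g : ℕ → Word
g n = nth (Gupto n) (n ∸ 1)

pad : ℕ → Word → Word
pad k w = replicate (k ∸ length w) false ++ w

diff : Bool → Bool → ℕ
diff true false = 1
diff false true = 1
diff _ _ = 0

hamming : Word → Word → ℕ
hamming w w' = sum (zipWith diff (pad k w) (pad k w'))
  where k = length w ⊔ length w'

{-# OPTIONS --safe #-}
module Submission where

open import Defs
open import Data.Nat using (ℕ; zero; suc; _+_; _⊔_; _≤_; _<_; _≤′_; ≤′-refl; ≤′-step; z≤n; s≤s)
open import Data.Nat.Properties
open import Data.Nat.ListAction using (sum)
open import Data.Bool using (true; false)
open import Data.List using (List; []; _∷_; _++_; map; reverse; length; replicate; zipWith; [_])
open import Data.List.Properties
  using (∷-injectiveʳ; ++-assoc; ++-identityʳ; map-++; map-∘; map-id; length-++; length-map; length-reverse; unfold-reverse)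
open import Data.List.Relation.Unary.Any using (here; there)
import Data.List.Relation.Unary.Any.Properties as Any
import Data.List.Relation.Unary.All as All
open import Data.List.Relation.Unary.AllPairs using ([]; _∷_)
open import Data.List.Membership.Propositional using (_∈_)
open import Data.List.Membership.Propositional.Properties using (∈-map⁺; ∈-map⁻; ∈-++⁺ˡ; ∈-++⁺ʳ; ∈-++⁻)
open import Data.List.Relation.Unary.Unique.Propositional using (Unique)
import Data.List.Relation.Unary.Unique.Propositional.Properties as Unique
open import Data.Product using (_×_; _,_; ∃-syntax)
open import Data.Sum using (_⊎_; inj₁; inj₂)
open import Data.Empty using (⊥-elim)
open import Data.Unit using (tt)
open import Function using (_∘_)
open import Relation.Binary.PropositionalEquality hiding ([_])
open import Relation.Binary.Definitions using (tri<; tri≈; tri>)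
open import Relation.Nullary using (¬_; yes; no)
open import Data.List.Relation.Binary.Permutation.Setoid (setoid Word) using (↭-sym)
open import Data.List.Relation.Binary.Permutation.Setoid.Properties (setoid Word) using (Unique-resp-↭; ↭-reverse)

-- Write N (1 + n) = 1·Tails n. The recursion makes Tails (n + 2) a reflected Gray code:
-- 0·(Tails (n + 1) reversed) followed by 0·(1·Tails n reversed), the two halves glued by a
-- single flip of the second letter. By induction, Tails n lists each word u of length n with
-- 1u a ZF-word exactly once, has F (n + 1) entries, and consecutive entries are adjacent in
-- the hypercube. So N 1 + ⋯ + N M enumerates the nonzero ZF-words of length at most M
-- without repetition, has F (M + 2) − 1 entries, and its neighbours inside a block are at
-- Hamming distance 1. At the junction of N (m + 1) and N (m + 2), i.e. at position
-- F (m + 3) − 1, the neighbours are 1u and 10u for the last entry u of Tails m: distance 2.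

fib-pos : ∀ n → 0 < fib (suc n)
fib-pos zero = s≤s z≤n
fib-pos (suc n) = ≤-trans (fib-pos n) (m≤m+n _ _)

fib-step : ∀ n → fib n ≤ fib (suc n)
fib-step zero = z≤n
fib-step (suc n) = m≤m+n _ _

fib-mono : ∀ {m n} → m ≤ n → fib m ≤ fib n
fib-mono m≤n = go (≤⇒≤′ m≤n)
  where
  go : ∀ {m n} → m ≤′ n → fib m ≤ fib n
  go ≤′-refl = ≤-refl
  go (≤′-step {n} m≤′n) = ≤-trans (go m≤′n) (fib-step n)

n<fib[2+n] : ∀ n → n < fib (2 + n)
n<fib[2+n] zero = s≤s z≤n
n<fib[2+n] (suc n) = ≤-trans (s≤s (n<fib[2+n] n)) (m<m+n (fib (2 + n)) (fib-pos n))

fib-gap : ∀ m {x} → fib m < x → x < fib (suc m) → ∀ k → x ≢ fib k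
fib-gap m lo hi k refl with k ≤? m
... | yes k≤m = <⇒≱ lo (fib-mono k≤m)
... | no k≰m = <⇒≱ hi (fib-mono (≰⇒> k≰m))

nth-++ˡ : ∀ xs ys {i} → i < length xs → nth (xs ++ ys) i ≡ nth xs i
nth-++ˡ (x ∷ xs) ys {zero} _ = refl
nth-++ˡ (x ∷ xs) ys {suc i} (s≤s i<) = nth-++ˡ xs ys i<

nth-++ʳ : ∀ xs ys j → nth (xs ++ ys) (length xs + j) ≡ nth ys j
nth-++ʳ [] ys j = refl
nth-++ʳ (x ∷ xs) ys j = nth-++ʳ xs ys j

nth-∈ : ∀ xs {i} → i < length xs → nth xs i ∈ xs
nth-∈ (x ∷ xs) {zero} _ = here refl
nth-∈ (x ∷ xs) {suc i} (s≤s i<) = there (nth-∈ xs i<)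

∈⇒∃nth : ∀ {x : Word} {xs} → x ∈ xs → ∃[ i ] (i < length xs × nth xs i ≡ x)
∈⇒∃nth (here refl) = zero , s≤s z≤n , refl
∈⇒∃nth (there x∈) with ∈⇒∃nth x∈
... | i , i< , eq = suc i , s≤s i< , eq

nth-injective : ∀ {xs} → Unique xs → ∀ {i j} → i < length xs → j < length xs → nth xs i ≡ nth xs j → i ≡ j
nth-injective (_ ∷ _) {zero} {zero} _ _ _ = refl
nth-injective {x ∷ xs} (x∉ ∷ _) {zero} {suc j} _ (s≤s j<) eq = ⊥-elim (All.lookup x∉ (nth-∈ xs j<) eq)
nth-injective {x ∷ xs} (x∉ ∷ _) {suc i} {zero} (s≤s i<) _ eq = ⊥-elim (All.lookup x∉ (nth-∈ xs i<) (sym eq))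
nth-injective (_ ∷ u) {suc i} {suc j} (s≤s i<) (s≤s j<) eq = cong suc (nth-injective u i< j< eq)

unique-reverse : ∀ {xs : List Word} → Unique xs → Unique (reverse xs)
unique-reverse {xs} = Unique-resp-↭ (↭-sym (↭-reverse xs))

data Adjacent : Word → Word → Set where
  flip₁₀ : ∀ {u} → Adjacent (true ∷ u) (false ∷ u)
  flip₀₁ : ∀ {u} → Adjacent (false ∷ u) (true ∷ u)
  keep : ∀ {b u v} → Adjacent u v → Adjacent (b ∷ u) (b ∷ v)

Adjacent-sym : ∀ {u v} → Adjacent u v → Adjacent v u
Adjacent-sym flip₁₀ = flip₀₁
Adjacent-sym flip₀₁ = flip₁₀
Adjacent-sym (keep p) = keep (Adjacent-sym p)

data Walk : Word → Word → List Word → Set where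
  stay : ∀ {a} → Walk a a [ a ]
  step : ∀ {a b c xs} → Adjacent a b → Walk b c xs → Walk a c (a ∷ xs)

walk-++ : ∀ {a b c d xs ys} → Walk a b xs → Adjacent b c → Walk c d ys → Walk a d (xs ++ ys)
walk-++ stay b~c w = step b~c w
walk-++ (step a~a′ v) b~c w = step a~a′ (walk-++ v b~c w)

walk-reverse : ∀ {a b xs} → Walk a b xs → Walk b a (reverse xs)
walk-reverse stay = stay
walk-reverse {a} (step {xs = xs} a~b w) =
  subst (Walk _ a) (sym (unfold-reverse a xs)) (walk-++ (walk-reverse w) (Adjacent-sym a~b) stay)

walk-map : ∀ c {a b xs} → Walk a b xs → Walk (c ∷ a) (c ∷ b) (map (c ∷_) xs)
walk-map c stay = stay
walk-map c (step a~b w) = step (keep a~b) (walk-map c w)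

walk-head : ∀ {a b xs} → Walk a b xs → nth xs 0 ≡ a
walk-head stay = refl
walk-head (step _ _) = refl

walk-last : ∀ {a b xs} → Walk a b xs → ∀ ys i → suc i ≡ length (ys ++ xs) → nth (ys ++ xs) i ≡ b
walk-last stay [] zero _ = refl
walk-last (step _ w) [] (suc i) eq = walk-last w [] i (suc-injective eq)
walk-last w (_ ∷ ys) (suc i) eq = walk-last w ys i (suc-injective eq)
walk-last stay [] (suc i) ()
walk-last (step _ stay) [] zero ()
walk-last (step _ (step _ _)) [] zero ()
walk-last stay (_ ∷ []) zero ()
walk-last (step _ _) (_ ∷ []) zero ()
walk-last _ (_ ∷ _ ∷ _) zero ()

walk-Adjacent : ∀ {a b xs} → Walk a b xs → ∀ j → suc j < length xs → Adjacent (nth xs j) (nth xs (suc j))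
walk-Adjacent stay _ (s≤s ())
walk-Adjacent (step a~b stay) zero _ = a~b
walk-Adjacent (step a~b (step _ _)) zero _ = a~b
walk-Adjacent (step _ w) (suc j) (s≤s j<) = walk-Adjacent w j j<

pad-+ : ∀ d w → pad (d + length w) w ≡ replicate d false ++ w
pad-+ d w = cong (λ m → replicate m false ++ w) (m+n∸n≡m d (length w))

hamming-padded : ∀ d u v → length v ≡ d + length u →
                 hamming u v ≡ sum (zipWith diff (replicate d false ++ u) v)
hamming-padded d u v eq = cong₂ (λ x y → sum (zipWith diff x y)) pad-u pad-v
  where
  width≡ : length u ⊔ length v ≡ length v
  width≡ = m≤n⇒m⊔n≡n (subst (length u ≤_) (sym eq) (m≤n+m (length u) d))
  pad-u : pad (length u ⊔ length v) u ≡ replicate d false ++ u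
  pad-u = trans (cong (λ k → pad k u) (trans width≡ eq)) (pad-+ d u)
  pad-v : pad (length u ⊔ length v) v ≡ v
  pad-v = trans (cong (λ k → pad k v) width≡) (pad-+ 0 v)

sum-diff-self : ∀ u → sum (zipWith diff u u) ≡ 0
sum-diff-self [] = refl
sum-diff-self (true ∷ u) = sum-diff-self u
sum-diff-self (false ∷ u) = sum-diff-self u

sum-diff-Adjacent : ∀ {u v} → Adjacent u v → sum (zipWith diff u v) ≡ 1
sum-diff-Adjacent {_ ∷ u} flip₁₀ = cong suc (sum-diff-self u)
sum-diff-Adjacent {_ ∷ u} flip₀₁ = cong suc (sum-diff-self u)
sum-diff-Adjacent {true ∷ _} (keep p) = sum-diff-Adjacent p
sum-diff-Adjacent {false ∷ _} (keep p) = sum-diff-Adjacent p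

Adjacent-length : ∀ {u v} → Adjacent u v → length u ≡ length v
Adjacent-length flip₁₀ = refl
Adjacent-length flip₀₁ = refl
Adjacent-length (keep p) = cong suc (Adjacent-length p)

hamming-Adjacent : ∀ {u v} → Adjacent u v → hamming u v ≡ 1
hamming-Adjacent {u} {v} p = trans (hamming-padded 0 u v (sym (Adjacent-length p))) (sum-diff-Adjacent p)

hamming-1-10 : ∀ t → hamming (true ∷ t) (true ∷ false ∷ t) ≡ 2
hamming-1-10 t =
  trans (hamming-padded 1 (true ∷ t) (true ∷ false ∷ t) refl) (cong (2 +_) (sum-diff-self t))

Tails : ℕ → List Word
Tails zero = [ [] ]
Tails (suc zero) = [ [ false ] ]
Tails (suc (suc n)) = map (false ∷_) (reverse (Tails (suc n)) ++ reverse (map (true ∷_) (Tails n)))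

N-suc : ∀ n → N (suc n) ≡ map (true ∷_) (Tails n)
N-suc zero = refl
N-suc (suc zero) = refl
N-suc (suc (suc n)) = begin
  pre10 (reverse (map tail' (N (suc (suc n))))) ++ pre10 (reverse (N (suc n)))
    ≡⟨ cong₂ (λ xs ys → pre10 (reverse (map tail' xs)) ++ pre10 (reverse ys)) (N-suc (suc n)) (N-suc n) ⟩
  pre10 (reverse (map tail' (map (true ∷_) T₁))) ++ pre10 T₀
    ≡⟨ cong (λ xs → pre10 (reverse xs) ++ pre10 T₀) (trans (sym (map-∘ T₁)) (map-id T₁)) ⟩
  pre10 (reverse T₁) ++ pre10 T₀
    ≡⟨ sym (map-++ _ (reverse T₁) T₀) ⟩
  pre10 (reverse T₁ ++ T₀)
    ≡⟨ map-∘ (reverse T₁ ++ T₀) ⟩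
  map (true ∷_) (Tails (suc (suc n))) ∎
  where
  open ≡-Reasoning
  T₁ = Tails (suc n)
  T₀ = reverse (map (true ∷_) (Tails n))

ZF-tail : ∀ u → ZF (true ∷ u) → ZF u
ZF-tail [] _ = tt
ZF-tail (false ∷ u) zf = zf

Tails-sound : ∀ n {u} → u ∈ Tails n → length u ≡ n × ZF (true ∷ u)
Tails-sound zero (here refl) = refl , tt
Tails-sound (suc zero) (here refl) = refl , tt
Tails-sound (suc (suc n)) u∈ with ∈-map⁻ (false ∷_) u∈
... | v , v∈ , refl with ∈-++⁻ (reverse (Tails (suc n))) v∈
...   | inj₁ v∈T₁ with Tails-sound (suc n) (Any.reverse⁻ v∈T₁)
...     | len , zf = cong suc len , ZF-tail v zf
Tails-sound (suc (suc n)) u∈ | v , v∈ , refl | inj₂ v∈T₀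
  with ∈-map⁻ (true ∷_) (Any.reverse⁻ {xs = map (true ∷_) (Tails n)} v∈T₀)
...   | w , w∈ , refl with Tails-sound n w∈
...     | len , zf = cong (suc ∘ suc) len , zf

Tails-complete : ∀ u → ZF (true ∷ u) → u ∈ Tails (length u)
Tails-complete [] _ = here refl
Tails-complete (false ∷ []) _ = here refl
Tails-complete (false ∷ false ∷ u) zf =
  ∈-map⁺ (false ∷_) (∈-++⁺ˡ (Any.reverse⁺ (Tails-complete (false ∷ u) zf)))
Tails-complete (false ∷ true ∷ u) zf =
  ∈-map⁺ (false ∷_) (∈-++⁺ʳ _ (Any.reverse⁺ (∈-map⁺ (true ∷_) (Tails-complete u zf))))

Tails-unique : ∀ n → Unique (Tails n)
Tails-unique zero = All.[] ∷ []
Tails-unique (suc zero) = All.[] ∷ []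
Tails-unique (suc (suc n)) = Unique.map⁺ ∷-injectiveʳ (Unique.++⁺
  (unique-reverse (Tails-unique (suc n)))
  (unique-reverse (Unique.map⁺ ∷-injectiveʳ (Tails-unique n)))
  disjoint)
  where
  disjoint : ∀ {v} → ¬ (v ∈ reverse (Tails (suc n)) × v ∈ reverse (map (true ∷_) (Tails n)))
  disjoint (v∈T₁ , v∈T₀)
    with ∈-map⁻ (true ∷_) (Any.reverse⁻ {xs = map (true ∷_) (Tails n)} v∈T₀)
       | Tails-sound (suc n) (Any.reverse⁻ v∈T₁)
  ... | _ , _ , refl | _ , ()

length-Tails : ∀ n → length (Tails n) ≡ fib (suc n)
length-Tails zero = refl
length-Tails (suc zero) = refl
length-Tails (suc (suc n)) = begin
  length (map (false ∷_) (reverse T₁ ++ reverse T₀))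
    ≡⟨ length-map _ (reverse T₁ ++ reverse T₀) ⟩
  length (reverse T₁ ++ reverse T₀)
    ≡⟨ length-++ (reverse T₁) ⟩
  length (reverse T₁) + length (reverse T₀)
    ≡⟨ cong₂ _+_ (trans (length-reverse T₁) (length-Tails (suc n)))
                 (trans (length-reverse T₀) (trans (length-map _ (Tails n)) (length-Tails n))) ⟩
  fib (3 + n) ∎
  where
  open ≡-Reasoning
  T₁ = Tails (suc n)
  T₀ = map (true ∷_) (Tails n)

firstTail lastTail : ℕ → Word
firstTail zero = []
firstTail (suc n) = false ∷ lastTail n
lastTail zero = []
lastTail (suc zero) = [ false ]
lastTail (suc (suc n)) = false ∷ true ∷ firstTail n

walk-Tails : ∀ n → Walk (firstTail n) (lastTail n) (Tails n)
walk-Tails zero = stay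
walk-Tails (suc zero) = stay
walk-Tails (suc (suc n)) = walk-map false
  (walk-++ (walk-reverse (walk-Tails (suc n))) flip₀₁ (walk-reverse (walk-map true (walk-Tails n))))

walk-N : ∀ n → Walk (true ∷ firstTail n) (true ∷ lastTail n) (N (suc n))
walk-N n = subst (Walk _ _) (sym (N-suc n)) (walk-map true (walk-Tails n))

length-N : ∀ n → length (N (suc n)) ≡ fib (suc n)
length-N n = trans (cong length (N-suc n)) (trans (length-map _ (Tails n)) (length-Tails n))

∈N⁻ : ∀ {m w} → w ∈ N (suc m) → ∃[ u ] (w ≡ true ∷ u × length u ≡ m × ZF (true ∷ u))
∈N⁻ {m} w∈ with ∈-map⁻ (true ∷_) (subst (_ ∈_) (N-suc m) w∈)
... | u , u∈ , refl = u , refl , Tails-sound m u∈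

N-unique : ∀ m → Unique (N (suc m))
N-unique m = subst Unique (sym (N-suc m)) (Unique.map⁺ ∷-injectiveʳ (Tails-unique m))

length-Gupto : ∀ M → suc (length (Gupto M)) ≡ fib (2 + M)
length-Gupto zero = refl
length-Gupto (suc M) = trans (cong suc (length-++ (Gupto M))) (cong₂ _+_ (length-Gupto M) (length-N M))

n≤length-Gupto : ∀ M → M ≤ length (Gupto M)
n≤length-Gupto M = ≤-pred (≤-trans (n<fib[2+n] M) (≤-reflexive (sym (length-Gupto M))))

∈Gupto⁻ : ∀ {M w} → w ∈ Gupto M → ∃[ u ] (w ≡ true ∷ u × length u < M × ZF (true ∷ u))
∈Gupto⁻ {suc M} w∈ with ∈-++⁻ (Gupto M) w∈
... | inj₁ w∈G with ∈Gupto⁻ {M} w∈G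
...   | u , eq , u< , zf = u , eq , m<n⇒m<1+n u< , zf
∈Gupto⁻ {suc M} w∈ | inj₂ w∈N with ∈N⁻ {M} w∈N
...   | u , eq , len , zf = u , eq , ≤-reflexive (cong suc len) , zf

Gupto-unique : ∀ M → Unique (Gupto M)
Gupto-unique zero = []
Gupto-unique (suc M) = Unique.++⁺ (Gupto-unique M) (N-unique M) disjoint
  where
  disjoint : ∀ {w} → ¬ (w ∈ Gupto M × w ∈ N (suc M))
  disjoint (w∈G , w∈N) with ∈Gupto⁻ {M} w∈G | ∈N⁻ {M} w∈N
  ... | u , refl , u< , _ | _ , refl , len , _ = <-irrefl len u<

Gupto-prefix : ∀ {m n} → m ≤ n → ∃[ zs ] Gupto n ≡ Gupto m ++ zs
Gupto-prefix m≤n = go (≤⇒≤′ m≤n)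
  where
  go : ∀ {m n} → m ≤′ n → ∃[ zs ] Gupto n ≡ Gupto m ++ zs
  go {m} ≤′-refl = [] , sym (++-identityʳ (Gupto m))
  go {m} (≤′-step {n} m≤′n) with go m≤′n
  ... | zs , eq = zs ++ N (suc n) , trans (cong (_++ N (suc n)) eq) (++-assoc (Gupto m) zs (N (suc n)))

nth-Gupto-mono : ∀ {m n i} → m ≤ n → i < length (Gupto m) → nth (Gupto n) i ≡ nth (Gupto m) i
nth-Gupto-mono {m} {i = i} m≤n i< with Gupto-prefix m≤n
... | zs , eq = trans (cong (λ xs → nth xs i) eq) (nth-++ˡ (Gupto m) zs i<)

g-nth : ∀ K {i} → i < length (Gupto K) → g (suc i) ≡ nth (Gupto K) i
g-nth K {i} i< with ≤-total (suc i) K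
... | inj₁ 1+i≤K = sym (nth-Gupto-mono 1+i≤K (n≤length-Gupto (suc i)))
... | inj₂ K≤1+i = nth-Gupto-mono K≤1+i i<

g-shape : ∀ i → ∃[ u ] (g (suc i) ≡ true ∷ u × ZF (true ∷ u))
g-shape i with ∈Gupto⁻ {suc i} (nth-∈ (Gupto (suc i)) (n≤length-Gupto (suc i)))
... | u , eq , _ , zf = u , eq , zf

strip-g : ∀ i → strip (g (suc i)) ≡ g (suc i)
strip-g i with g-shape i
... | u , eq , _ = trans (cong strip eq) (sym eq)

g-surjective : ∀ u → ZF (true ∷ u) → ∃[ i ] g (suc i) ≡ true ∷ u
g-surjective u zf with ∈⇒∃nth 1u∈G
  where
  1u∈G : true ∷ u ∈ Gupto (suc (length u))
  1u∈G = ∈-++⁺ʳ (Gupto (length u))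
    (subst (true ∷ u ∈_) (sym (N-suc (length u))) (∈-map⁺ (true ∷_) (Tails-complete u zf)))
... | i , i< , eq = i , trans (g-nth (suc (length u)) i<) eq

g-injective : ∀ i j → g (suc i) ≡ g (suc j) → i ≡ j
g-injective i j eq =
  nth-injective (Gupto-unique K) i< j< (trans (sym (g-nth K i<)) (trans eq (g-nth K j<)))
  where
  K = suc i ⊔ suc j
  i< : i < length (Gupto K)
  i< = ≤-trans (m≤m⊔n (suc i) (suc j)) (n≤length-Gupto K)
  j< : j < length (Gupto K)
  j< = ≤-trans (m≤n⊔m (suc i) (suc j)) (n≤length-Gupto K)

-- Position n of 𝒢 is the last entry of a block N (k − 2) exactly when n + 1 = F k with k ≥ 3.
BlockEnd : ℕ → Set
BlockEnd n = ∃[ k ] (3 ≤ k × suc n ≡ fib k)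

Jump : ℕ → Word → Word → Set
Jump n x y = (BlockEnd n × hamming x y ≡ 2) ⊎ (¬ BlockEnd n × hamming x y ≡ 1)

jump-at-block-end : ∀ M i → suc i ≡ length (Gupto M) →
                    Jump (suc i) (nth (Gupto (suc M)) i) (nth (Gupto (suc M)) (suc i))
jump-at-block-end (suc M) i eq = inj₁ ((3 + M , s≤s (s≤s (s≤s z≤n)) , fib-eq) , hamming≡2)
  where
  fib-eq : suc (suc i) ≡ fib (3 + M)
  fib-eq = trans (cong suc eq) (length-Gupto (suc M))
  last≡ : nth (Gupto (2 + M)) i ≡ true ∷ lastTail M
  last≡ = trans (nth-++ˡ (Gupto (suc M)) (N (2 + M)) (≤-reflexive eq))
                (walk-last (walk-N M) (Gupto M) i eq)
  next≡ : nth (Gupto (2 + M)) (suc i) ≡ true ∷ false ∷ lastTail M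
  next≡ = begin
    nth (Gupto (2 + M)) (suc i)
      ≡⟨ cong (nth (Gupto (2 + M))) (trans eq (sym (+-identityʳ _))) ⟩
    nth (Gupto (2 + M)) (length (Gupto (suc M)) + 0)
      ≡⟨ nth-++ʳ (Gupto (suc M)) (N (2 + M)) 0 ⟩
    nth (N (2 + M)) 0
      ≡⟨ walk-head (walk-N (suc M)) ⟩
    true ∷ false ∷ lastTail M ∎
    where open ≡-Reasoning
  hamming≡2 : hamming (nth (Gupto (2 + M)) i) (nth (Gupto (2 + M)) (suc i)) ≡ 2
  hamming≡2 = trans (cong₂ hamming last≡ next≡) (hamming-1-10 (lastTail M))

jump-within-block : ∀ M j → suc j < length (N (suc M)) →
                    Jump (suc (length (Gupto M) + j)) (nth (Gupto (suc M)) (length (Gupto M) + j))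
                                                      (nth (Gupto (suc M)) (suc (length (Gupto M) + j)))
jump-within-block M j 1+j< =
  inj₂ (not-end , trans (cong₂ hamming at-j at-1+j) (hamming-Adjacent adjacent))
  where
  L = length (Gupto M)
  at-j : nth (Gupto (suc M)) (L + j) ≡ nth (N (suc M)) j
  at-j = nth-++ʳ (Gupto M) (N (suc M)) j
  at-1+j : nth (Gupto (suc M)) (suc (L + j)) ≡ nth (N (suc M)) (suc j)
  at-1+j = trans (cong (nth (Gupto (suc M))) (sym (+-suc L j))) (nth-++ʳ (Gupto M) (N (suc M)) (suc j))
  adjacent : Adjacent (nth (N (suc M)) j) (nth (N (suc M)) (suc j))
  adjacent = walk-Adjacent (walk-N M) j 1+j<
  open ≤-Reasoning
  lo : fib (2 + M) < suc (suc (L + j))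
  lo = begin-strict
    fib (2 + M)        ≡⟨ sym (length-Gupto M) ⟩
    suc L              ≤⟨ s≤s (m≤m+n L j) ⟩
    suc (L + j)        <⟨ n<1+n _ ⟩
    suc (suc (L + j))  ∎
  hi : suc (suc (L + j)) < fib (3 + M)
  hi = begin-strict
    suc (suc (L + j))          ≡⟨ cong suc (sym (+-suc L j)) ⟩
    suc (L + suc j)            <⟨ s≤s (+-monoʳ-< L 1+j<) ⟩
    suc L + length (N (suc M)) ≡⟨ cong₂ _+_ (length-Gupto M) (length-N M) ⟩
    fib (3 + M)                ∎
  not-end : ¬ BlockEnd (suc (L + j))
  not-end (k , _ , eq) = fib-gap (2 + M) lo hi k eq

Gupto-jump : ∀ M i → suc i < length (Gupto M) → Jump (suc i) (nth (Gupto M) i) (nth (Gupto M) (suc i))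
Gupto-jump (suc M) i 1+i< with <-cmp (suc i) (length (Gupto M))
... | tri< 1+i<L _ _ = subst₂ (Jump (suc i))
  (sym (nth-++ˡ (Gupto M) (N (suc M)) (<-trans (n<1+n i) 1+i<L)))
  (sym (nth-++ˡ (Gupto M) (N (suc M)) 1+i<L))
  (Gupto-jump M i 1+i<L)
... | tri≈ _ 1+i≡L _ = jump-at-block-end M i 1+i≡L
... | tri> _ _ L<1+i with m≤n⇒∃[o]m+o≡n (≤-pred L<1+i)
...   | j , refl = jump-within-block M j (+-cancelˡ-≤ L (suc (suc j)) _ L+1+j<)
  where
  L = length (Gupto M)
  L+1+j< : L + suc (suc j) ≤ L + length (N (suc M))
  L+1+j< = begin
    L + suc (suc j)          ≡⟨ trans (+-suc L (suc j)) (cong suc (+-suc L j)) ⟩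
    suc (suc (L + j))        ≤⟨ 1+i< ⟩
    length (Gupto (suc M))   ≡⟨ length-++ (Gupto M) ⟩
    L + length (N (suc M))   ∎
    where open ≤-Reasoning

g-jump : ∀ i → Jump (suc i) (g (suc i)) (g (suc (suc i)))
g-jump i = subst₂ (Jump (suc i)) (sym (g-nth K (<-trans (n<1+n i) 1+i<))) (sym (g-nth K 1+i<))
                  (Gupto-jump K i 1+i<)
  where
  K = 2 + i
  1+i< : suc i < length (Gupto K)
  1+i< = n≤length-Gupto K

strip-nonzero : ∀ w → ZF w → NonzeroWord w → ∃[ u ] (strip w ≡ true ∷ u × ZF (true ∷ u))
strip-nonzero (true ∷ u) zf _ = u , refl , zf
strip-nonzero (false ∷ w) zf (there nz) = strip-nonzero w zf nz

occurs-exactly-once : (w : Word) → ZF w → NonzeroWord w →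
                      ∃[ n ] (1 ≤ n × g n ≈w w × ((m : ℕ) → 1 ≤ m → g m ≈w w → m ≡ n))
occurs-exactly-once w zf nz with strip-nonzero w zf nz
... | u , strip≡ , zfu with g-surjective u zfu
...   | i , gi = suc i , s≤s z≤n , gi≈w , only
  where
  gi≈w : g (suc i) ≈w w
  gi≈w = trans (cong strip gi) (sym strip≡)
  only : (m : ℕ) → 1 ≤ m → g m ≈w w → m ≡ suc i
  only (suc j) _ gj≈w = cong suc (g-injective j i
    (trans (sym (strip-g j)) (trans gj≈w (trans (sym gi≈w) (strip-g i)))))

theorem2p7 :
    ((n : ℕ) → 1 ≤ n → ZF (g n) × NonzeroWord (g n))
    × ((w : Word) → ZF w → NonzeroWord w →
        ∃[ n ] (1 ≤ n × g n ≈w w × ((m : ℕ) → 1 ≤ m → g m ≈w w → m ≡ n)))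
    × ((n : ℕ) → 1 ≤ n →
        ((∃[ k ] (3 ≤ k × suc n ≡ fib k)) → hamming (g n) (g (suc n)) ≡ 2)
        × (¬ (∃[ k ] (3 ≤ k × suc n ≡ fib k)) → hamming (g n) (g (suc n)) ≡ 1))
theorem2p7 = nonzero-ZF , occurs-exactly-once , hamming-steps
  where
  nonzero-ZF : (n : ℕ) → 1 ≤ n → ZF (g n) × NonzeroWord (g n)
  nonzero-ZF (suc i) _ with g-shape i
  ... | u , eq , zf = subst ZF (sym eq) zf , subst NonzeroWord (sym eq) (here refl)

  hamming-steps : (n : ℕ) → 1 ≤ n →
    (BlockEnd n → hamming (g n) (g (suc n)) ≡ 2) × (¬ BlockEnd n → hamming (g n) (g (suc n)) ≡ 1)
  hamming-steps (suc i) _ with g-jump i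
  ... | inj₁ (end , h≡2) = (λ _ → h≡2) , (λ not-end → ⊥-elim (not-end end))
  ... | inj₂ (not-end , h≡1) = (λ end → ⊥-elim (not-end end)) , (λ _ → h≡1)
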